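{- Let $n,r,k\in\mathbb N$ with $r\geq 2$, $r$ dividing $n$, and $1\leq k\leq n/r$. Then there exists a graph $G$ on $n$ vertices whose degree sequence $d_1\leq\dots\leq d_n$ satisfies $d_{n-i(r-1)+1}\geq n-i$ for all $i\in\{1,\dots,n/r\}\setminus\{k\}$, and $d_{n-k(r-1)+1}=n-k-1$, but such that $G$ does not contain a perfect $K_r$-packing.
   Context: A perfect $K_r$-packing in $G$ is a collection of vertex-disjoint copies of the complete graph $K_r$ in $G$ covering all vertices of $G$. The degree sequence lists vertex degrees in non-decreasing order. -}

module Defs where

open import Data.Nat using (ℕ; zero; suc; _∸_; _+_; _*_)
open import Data.Nat.Properties using (≤-decTotalOrder)
open import Data.Bool using (Bool; true; false)
import Data.Bool as B
open import Data.Fin using (Fin)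
import Data.Fin as F
open import Data.List using (List; []; _∷_; length; filter; map; allFin)
open import Data.Product using (Σ; _×_)
open import Relation.Binary.PropositionalEquality using (_≡_; _≢_)
open import Relation.Nullary using (¬_)
import Data.List.Sort

record Graph (n : ℕ) : Set where
  field
    adj   : Fin n → Fin n → Bool
    sym   : ∀ u v → adj u v ≡ adj v u
    irrefl : ∀ u → adj u u ≡ false
open Graph public

degree : ∀ {n} → Graph n → Fin n → ℕ
degree G u = length (filter (λ v → adj G u v B.≟ true) (allFin _))

open Data.List.Sort ≤-decTotalOrder using (sort)

degreeSequence : ∀ {n} → Graph n → List ℕ
degreeSequence G = sort (map (degree G) (allFin _))

-- 1-based indexing into a list (value 0 out of range; never used out of range here)
nth : List ℕ → ℕ → ℕ
nth [] _ = 0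
nth (x ∷ xs) zero = 0
nth (x ∷ xs) (suc zero) = x
nth (x ∷ xs) (suc (suc i)) = nth xs (suc i)

PerfectPacking : ∀ {n} → ℕ → Graph n → Set
PerfectPacking {n} r G =
  Σ ℕ λ m → Σ (Fin n → Fin m) λ c →
    (∀ j → length (filter (λ v → c v F.≟ j) (allFin n)) ≡ r) ×
    (∀ u v → u ≢ v → c u ≡ c v → adj G u v ≡ true)

-- Take K_n, single out the first k vertices X and the last k(r − 1) − 1 vertices Z,
-- and delete every edge between X and a vertex outside Z. Then X has degree
-- k(r − 1) − 1 ≤ n − k − 1, the middle vertices Y have degree n − k − 1 and Z has
-- degree n − 1, which gives the required degree sequence. In a perfect K_r-packing every
-- vertex of X would need r − 1 partners of its own in Z, but |Z| < k(r − 1).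
module Submission where

open import Data.Bool using (Bool; true; false; if_then_else_) renaming (_≟_ to _≟ᵇ_)
open import Data.Fin using (Fin; zero; suc; toℕ)
open import Data.Fin.Properties using (any?; _≟_; toℕ<n)
open import Data.List using (_∷_; length; filter; tabulate; allFin; map; applyUpTo)
open import Data.List.Properties using (map-tabulate; tabulate-cong)
open import Data.List.Relation.Binary.Permutation.Propositional using (↭⇒↭ₛ)
open import Data.List.Relation.Binary.Pointwise using (Pointwise-≡⇒≡)
open import Data.Nat hiding (_≟_)
import Data.Nat as ℕ
open import Data.Nat.Divisibility using (_∣_; quotient; divides)
open import Data.Nat.Properties hiding (_≟_)
open import Algebra.Properties.Semiring.Sum +-*-semiring
  using (sum-syntax; ∑-comm; ∑-distrib-+; sum-cong-≗; sum-replicate-zero; *-distribˡ-sum)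
open import Data.List.Relation.Unary.Sorted.TotalOrder ≤-totalOrder using (Sorted)
open import Data.List.Relation.Unary.Sorted.TotalOrder.Properties using (↗↭↗⇒≋; applyUpTo⁺₂)
open import Data.List.Sort ≤-decTotalOrder using (sort; sort-↭; sort-↗)
open import Data.Product using (Σ; _×_; _,_; proj₁)
open import Data.Sum using (_⊎_; inj₁; inj₂)
open import Function using (id; _∘_; _⇔_; mk⇔; Equivalence)
open import Level using (Level; 0ℓ)
open import Relation.Binary.Definitions using (tri<; tri≈; tri>)
open import Relation.Binary.PropositionalEquality
  using (_≡_; _≢_; refl; sym; trans; cong; cong₂; subst; subst₂; module ≡-Reasoning)
open import Relation.Nullary using (¬_; Dec; does; yes; no; ¬?)
open import Relation.Nullary.Decidable using (dec-true; dec-false; does-⇔; _×-dec_)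
open import Relation.Nullary.Negation using (contradiction)
open import Relation.Unary using (Pred; Decidable)

open import Defs hiding (sym)

private variable
  a b c p q r : Level
  A : Set a

[_] : Bool → ℕ
[ true ] = 1
[ false ] = 0

count : ∀ {n} {P : Pred (Fin n) p} → Decidable P → ℕ
count {n = n} P? = ∑[ v < n ] [ does (P? v) ]

length-filter-tabulate : ∀ {n} {P : Pred A p} (P? : Decidable P) (f : Fin n → A) →
                         length (filter P? (tabulate f)) ≡ count (P? ∘ f)
length-filter-tabulate {n = zero} P? f = refl
length-filter-tabulate {n = suc n} P? f with does (P? (f zero))
... | true = cong suc (length-filter-tabulate P? (f ∘ suc))
... | false = length-filter-tabulate P? (f ∘ suc)

length-filter-allFin : ∀ {n} {P : Pred (Fin n) p} (P? : Decidable P) →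
                       length (filter P? (allFin n)) ≡ count P?
length-filter-allFin P? = length-filter-tabulate P? id

count-cong : ∀ {n} {P : Pred (Fin n) p} {Q : Pred (Fin n) q} (P? : Decidable P) (Q? : Decidable Q) →
             (∀ v → P v ⇔ Q v) → count P? ≡ count Q?
count-cong P? Q? P⇔Q = sum-cong-≗ (λ v → cong [_] (does-⇔ (P⇔Q v) (P? v) (Q? v)))

∑-mono-≤ : ∀ {n} {f g : Fin n → ℕ} → (∀ i → f i ≤ g i) → ∑[ i < n ] f i ≤ ∑[ i < n ] g i
∑-mono-≤ {zero} _ = z≤n
∑-mono-≤ {suc n} f≤g = +-mono-≤ (f≤g zero) (∑-mono-≤ (f≤g ∘ suc))

module _ {A : Set a} {B : Set b} where

  [does]-mono : (A → B) → (a? : Dec A) (b? : Dec B) → [ does a? ] ≤ [ does b? ]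
  [does]-mono A→B (no _) _ = z≤n
  [does]-mono A→B (yes _) (yes _) = ≤-refl
  [does]-mono A→B (yes a) (no ¬b) = contradiction (A→B a) ¬b

  [does]-∪ : ∀ {C : Set c} → (A → B ⊎ C) → (a? : Dec A) (b? : Dec B) (c? : Dec C) →
             [ does a? ] ≤ [ does b? ] + [ does c? ]
  [does]-∪ A→B⊎C (no _) _ _ = z≤n
  [does]-∪ A→B⊎C (yes a) b? c? with A→B⊎C a
  ... | inj₁ b rewrite dec-true b? b = s≤s z≤n
  ... | inj₂ c rewrite dec-true c? c = m≤n+m 1 [ does b? ]

does≡true⇔ : (a? : Dec A) → does a? ≡ true ⇔ A
does≡true⇔ (yes a) = mk⇔ (λ _ → a) (λ _ → refl)
does≡true⇔ (no ¬a) = mk⇔ (λ ()) (λ a → contradiction a ¬a)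

module _ {n} {P : Pred (Fin n) p} (P? : Decidable P) where

  count-mono : ∀ {Q : Pred (Fin n) q} (Q? : Decidable Q) → (∀ {v} → P v → Q v) → count P? ≤ count Q?
  count-mono Q? P⊆Q = ∑-mono-≤ {n} (λ v → [does]-mono P⊆Q (P? v) (Q? v))

  count-∪ : ∀ {Q : Pred (Fin n) q} {R : Pred (Fin n) r} (Q? : Decidable Q) (R? : Decidable R) →
            (∀ {v} → P v → Q v ⊎ R v) → count P? ≤ count Q? + count R?
  count-∪ Q? R? P⊆Q∪R = ≤-trans (∑-mono-≤ {n} (λ v → [does]-∪ P⊆Q∪R (P? v) (Q? v) (R? v)))
                                (≤-reflexive (∑-distrib-+ {n} _ _))

  count-empty : (∀ v → ¬ P v) → count P? ≡ 0
  count-empty none = trans (sum-cong-≗ {n} (λ v → cong [_] (dec-false (P? v) (none v)))) (sum-replicate-zero n)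

count-singleton : ∀ {n} (x : Fin n) → count (x ≟_) ≡ 1
count-singleton {suc n} zero = cong suc (sum-replicate-zero n)
count-singleton (suc x) = count-singleton x

count-partition : ∀ {n m} {P : Pred (Fin n) p} (P? : Decidable P) (c : Fin n → Fin m) →
                  ∑[ j < m ] count (λ v → P? v ×-dec c v ≟ j) ≡ count P?
count-partition {n = n} {m = m} P? c = trans (∑-comm {m} {n} _) (sum-cong-≗ {n} column)
  where
  column : ∀ v → ∑[ j < m ] [ does (P? v ×-dec c v ≟ j) ] ≡ [ does (P? v) ]
  column v with does (P? v)
  ... | true = count-singleton (c v)
  ... | false = sum-replicate-zero m

countBelow : ∀ n {P : Pred ℕ p} → Decidable P → ℕ
countBelow n P? = count {n = n} (P? ∘ toℕ)

countBelow-cong : ∀ {n} {P : Pred ℕ p} {Q : Pred ℕ q} (P? : Decidable P) (Q? : Decidable Q) →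
                  (∀ j → P j ⇔ Q j) → countBelow n P? ≡ countBelow n Q?
countBelow-cong {n = n} P? Q? P⇔Q = count-cong {n = n} (P? ∘ toℕ) (Q? ∘ toℕ) (P⇔Q ∘ toℕ)

countBelow-+ : ∀ m n {P : Pred ℕ p} (P? : Decidable P) →
               countBelow (m + n) P? ≡ countBelow m P? + countBelow n (P? ∘ (m +_))
countBelow-+ zero n P? = refl
countBelow-+ (suc m) n P? =
  trans (cong ([ does (P? 0) ] +_) (countBelow-+ m n (P? ∘ suc)))
        (sym (+-assoc [ does (P? 0) ] (countBelow m (P? ∘ suc)) _))

countBelow-full : ∀ n {P : Pred ℕ p} (P? : Decidable P) → (∀ j → j < n → P j) →
                  countBelow n P? ≡ n
countBelow-full zero P? all = refl
countBelow-full (suc n) P? all rewrite dec-true (P? 0) (all 0 z<s) =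
  cong suc (countBelow-full n (P? ∘ suc) (λ j j<n → all (suc j) (s<s j<n)))

countBelow-empty : ∀ n {P : Pred ℕ p} (P? : Decidable P) → (∀ j → j < n → ¬ P j) →
                   countBelow n P? ≡ 0
countBelow-empty zero P? none = refl
countBelow-empty (suc n) P? none rewrite dec-false (P? 0) (none 0 z<s) =
  countBelow-empty n (P? ∘ suc) (λ j j<n → none (suc j) (s<s j<n))

countBelow-split : ∀ {a n} {P : Pred ℕ p} (P? : Decidable P) → a ≤ n →
                   countBelow n P? ≡ countBelow a P? + countBelow (n ∸ a) (P? ∘ (a +_))
countBelow-split {a = a} {n = n} P? a≤n =
  trans (cong (λ m → countBelow m P?) (sym (m+[n∸m]≡n a≤n))) (countBelow-+ a (n ∸ a) P?)

countBelow-from : ∀ {a n} {P : Pred ℕ p} (P? : Decidable P) → a ≤ n → (∀ j → j < a → ¬ P j) →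
                  countBelow n P? ≡ countBelow (n ∸ a) (P? ∘ (a +_))
countBelow-from {a = a} {n = n} P? a≤n none =
  trans (countBelow-split P? a≤n) (cong (_+ countBelow (n ∸ a) (P? ∘ (a +_))) (countBelow-empty a P? none))

countBelow-≥ : ∀ {a n} → a ≤ n → countBelow n (a ≤?_) ≡ n ∸ a
countBelow-≥ {a} {n} a≤n = trans (countBelow-from (a ≤?_) a≤n (λ _ → <⇒≱))
                                 (countBelow-full (n ∸ a) (λ j → a ≤? a + j) (λ j _ → m≤m+n a j))

countBelow-< : ∀ {a n} → a ≤ n → countBelow n (_<? a) ≡ a
countBelow-< {a} {n} a≤n = begin
  countBelow n (_<? a)                                          ≡⟨ countBelow-split (_<? a) a≤n ⟩
  countBelow a (_<? a) + countBelow (n ∸ a) (λ j → a + j <? a)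
    ≡⟨ cong₂ _+_ (countBelow-full a (_<? a) (λ _ j<a → j<a))
                 (countBelow-empty (n ∸ a) (λ j → a + j <? a) (λ j _ → m+n≮m a j)) ⟩
  a + 0                                                         ≡⟨ +-identityʳ a ⟩
  a                                                             ∎
  where open ≡-Reasoning

countBelow-≢ : ∀ {i n} → i < n → countBelow n (λ j → ¬? (i ℕ.≟ j)) ≡ n ∸ 1
countBelow-≢ {zero} {suc n} _ = countBelow-full n (λ j → ¬? (0 ℕ.≟ suc j)) (λ _ _ ())
countBelow-≢ {suc i} {suc (suc n)} (s<s i<n) = cong suc (countBelow-≢ i<n)

module _ {n} (G : Graph n) {X Z : Pred (Fin n) p} (X? : Decidable X) (Z? : Decidable Z)
         (N[X]⊆Z : ∀ {x v} → X x → adj G x v ≡ true → Z v)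
         (X∩Z≡∅ : ∀ {v} → X v → ¬ Z v) where

  module _ {m} (c : Fin n → Fin m) (clique : ∀ u v → u ≢ v → c u ≡ c v → adj G u v ≡ true)
           (j : Fin m) where

    C? : Decidable (λ v → c v ≡ j)
    C? v = c v ≟ j

    X∩C? : Decidable (λ v → X v × c v ≡ j)
    X∩C? v = X? v ×-dec C? v

    Z∩C? : Decidable (λ v → Z v × c v ≡ j)
    Z∩C? v = Z? v ×-dec C? v

    -- If the class contains some x ∈ X, its other r − 1 members are neighbours of x,
    -- hence lie in Z; in particular x is its only member in X.
    clique-class-bound : ∀ {r} → count C? ≡ r → (r ∸ 1) * count X∩C? ≤ count Z∩C?
    clique-class-bound {r} size with any? X∩C?
    ... | no ∄x rewrite count-empty X∩C? (λ v x → ∄x (v , x)) | *-zeroʳ (r ∸ 1) = z≤n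
    ... | yes (x , Xx , cx≡j) = begin
      (r ∸ 1) * count X∩C?  ≤⟨ *-monoʳ-≤ (r ∸ 1) X∩C≤1 ⟩
      (r ∸ 1) * 1           ≡⟨ *-identityʳ (r ∸ 1) ⟩
      r ∸ 1                 ≤⟨ ∸-monoˡ-≤ 1 r≤1+Z∩C ⟩
      count Z∩C?            ∎
      where
      open ≤-Reasoning

      C⊆x∪Z∩C : ∀ {v} → c v ≡ j → x ≡ v ⊎ (Z v × c v ≡ j)
      C⊆x∪Z∩C {v} cv≡j with x ≟ v
      ... | yes x≡v = inj₁ x≡v
      ... | no x≢v = inj₂ (N[X]⊆Z Xx (clique x v x≢v (trans cx≡j (sym cv≡j))) , cv≡j)

      r≤1+Z∩C : r ≤ 1 + count Z∩C?
      r≤1+Z∩C = begin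
        r                          ≡⟨ sym size ⟩
        count C?                   ≤⟨ count-∪ C? (x ≟_) Z∩C? C⊆x∪Z∩C ⟩
        count (x ≟_) + count Z∩C?  ≡⟨ cong (_+ count Z∩C?) (count-singleton x) ⟩
        1 + count Z∩C?             ∎

      X∩C≤1 : count X∩C? ≤ 1
      X∩C≤1 = begin
        count X∩C?    ≤⟨ count-mono X∩C? (x ≟_) X∩C⊆x ⟩
        count (x ≟_)  ≡⟨ count-singleton x ⟩
        1             ∎
        where
        X∩C⊆x : ∀ {v} → X v × c v ≡ j → x ≡ v
        X∩C⊆x (Xv , cv≡j) with C⊆x∪Z∩C cv≡j
        ... | inj₁ x≡v = x≡v
        ... | inj₂ (Zv , _) = contradiction Zv (X∩Z≡∅ Xv)

  small-neighbourhood⇒¬PerfectPacking : ∀ {r} → count Z? < (r ∸ 1) * count X? → ¬ PerfectPacking r G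
  small-neighbourhood⇒¬PerfectPacking {r} Z<rX (m , c , size , clique) = <⇒≱ Z<rX (begin
    (r ∸ 1) * count X?                              ≡⟨ cong ((r ∸ 1) *_) (sym (count-partition X? c)) ⟩
    (r ∸ 1) * (∑[ j < m ] count (X∩C? c clique j))  ≡⟨ *-distribˡ-sum {m} (r ∸ 1) _ ⟩
    ∑[ j < m ] ((r ∸ 1) * count (X∩C? c clique j))
      ≤⟨ ∑-mono-≤ {m} (λ j → clique-class-bound c clique j class-size) ⟩
    ∑[ j < m ] count (Z∩C? c clique j)              ≡⟨ count-partition Z? c ⟩
    count Z?                                        ∎)
    where
    open ≤-Reasoning
    class-size : ∀ {j} → count (C? c clique j) ≡ r
    class-size {j} = trans (sym (length-filter-allFin (C? c clique j))) (size j)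

AboveExcept : ℕ → ℕ → Pred ℕ 0ℓ
AboveExcept a i j = a ≤ j × i ≢ j

aboveExcept? : ∀ a i → Decidable (AboveExcept a i)
aboveExcept? a i j = a ≤? j ×-dec ¬? (i ℕ.≟ j)

module _ {a i n : ℕ} where

  countBelow-aboveExcept-< : i < a → a ≤ n → countBelow n (aboveExcept? a i) ≡ n ∸ a
  countBelow-aboveExcept-< i<a a≤n =
    trans (countBelow-from (aboveExcept? a i) a≤n (λ j j<a (a≤j , _) → <⇒≱ j<a a≤j))
          (countBelow-full (n ∸ a) (aboveExcept? a i ∘ (a +_))
                           (λ j _ → m≤m+n a j , <⇒≢ (<-≤-trans i<a (m≤m+n a j))))

  countBelow-aboveExcept-≥ : a ≤ i → i < n → countBelow n (aboveExcept? a i) ≡ n ∸ a ∸ 1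
  countBelow-aboveExcept-≥ a≤i i<n = begin
    countBelow n (aboveExcept? a i)
      ≡⟨ countBelow-from (aboveExcept? a i) (≤-trans a≤i (<⇒≤ i<n))
                         (λ j j<a (a≤j , _) → <⇒≱ j<a a≤j) ⟩
    countBelow (n ∸ a) (aboveExcept? a i ∘ (a +_))
      ≡⟨ countBelow-cong {n = n ∸ a} (aboveExcept? a i ∘ (a +_)) (λ j → ¬? (i ∸ a ℕ.≟ j))
           (λ j → mk⇔ (λ (_ , i≢a+j) → i≢a+j ∘ shift)
                      (λ i∸a≢j → m≤m+n a j , i∸a≢j ∘ unshift)) ⟩
    countBelow (n ∸ a) (λ j → ¬? (i ∸ a ℕ.≟ j))
      ≡⟨ countBelow-≢ (∸-monoˡ-< i<n a≤i) ⟩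
    n ∸ a ∸ 1 ∎
    where
    open ≡-Reasoning
    shift : ∀ {j} → i ∸ a ≡ j → i ≡ a + j
    shift refl = sym (m+[n∸m]≡n a≤i)
    unshift : ∀ {j} → i ≡ a + j → i ∸ a ≡ j
    unshift {j} refl = m+n∸m≡n a j

sort-sorted : ∀ {xs} → Sorted xs → sort xs ≡ xs
sort-sorted {xs} xs↗ =
  Pointwise-≡⇒≡ (↗↭↗⇒≋ ≤-totalOrder (sort-↗ xs) xs↗ (↭⇒↭ₛ (sort-↭ xs)))

tabulate-toℕ : ∀ n (f : ℕ → A) → tabulate {n = n} (f ∘ toℕ) ≡ applyUpTo f n
tabulate-toℕ zero f = refl
tabulate-toℕ (suc n) f = cong (f 0 ∷_) (tabulate-toℕ n (f ∘ suc))

nth-applyUpTo : ∀ {n p} (f : ℕ → ℕ) → p < n → nth (applyUpTo f n) (suc p) ≡ f p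
nth-applyUpTo {suc n} {zero} f _ = refl
nth-applyUpTo {suc n} {suc p} f (s<s p<n) = nth-applyUpTo (f ∘ suc) p<n

o<n⇒m∸n≤m∸o∸1 : ∀ {m n o} → o < n → m ∸ n ≤ m ∸ o ∸ 1
o<n⇒m∸n≤m∸o∸1 {m} {n} {o} o<n =
  subst (m ∸ n ≤_) (sym (trans (∸-+-assoc m o 1) (cong (m ∸_) (+-comm o 1)))) (∸-monoʳ-≤ m o<n)

module Construction (n k K : ℕ) (k<K : k < K) (K≤n : K ≤ n) where

  data Class (i : ℕ) : Set where
    inX : i < k → Class i
    inY : k ≤ i → i < K → Class i
    inZ : K ≤ i → Class i

  classify : ∀ i → Class i
  classify i with i <? k | i <? K
  ... | yes i<k | _       = inX i<k
  ... | no  i≮k | yes i<K = inY (≮⇒≥ i≮k) i<K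
  ... | no  _   | no  i≮K = inZ (≮⇒≥ i≮K)

  byClass : ℕ → ℕ → ℕ → ℕ → ℕ
  byClass x y z i = if does (i <? k) then x else if does (i <? K) then y else z

  module _ {x y z : ℕ} where

    byClass-X : ∀ {i} → i < k → byClass x y z i ≡ x
    byClass-X {i} i<k rewrite dec-true (i <? k) i<k = refl

    byClass-Y : ∀ {i} → k ≤ i → i < K → byClass x y z i ≡ y
    byClass-Y {i} k≤i i<K rewrite dec-false (i <? k) (≤⇒≯ k≤i) | dec-true (i <? K) i<K = refl

    byClass-Z : ∀ {i} → K ≤ i → byClass x y z i ≡ z
    byClass-Z {i} K≤i
      rewrite dec-false (i <? k) (≤⇒≯ (≤-trans (<⇒≤ k<K) K≤i)) | dec-false (i <? K) (≤⇒≯ K≤i) = refl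

    byClass-mono : x ≤ y → y ≤ z → ∀ {i j} → i ≤ j → byClass x y z i ≤ byClass x y z j
    byClass-mono x≤y y≤z {i} {j} i≤j with classify i | classify j
    ... | inX i<k     | inX j<k     = ≤-reflexive (trans (byClass-X i<k) (sym (byClass-X j<k)))
    ... | inX i<k     | inY k≤j j<K = subst₂ _≤_ (sym (byClass-X i<k)) (sym (byClass-Y k≤j j<K)) x≤y
    ... | inX i<k     | inZ K≤j     = subst₂ _≤_ (sym (byClass-X i<k)) (sym (byClass-Z K≤j)) (≤-trans x≤y y≤z)
    ... | inY k≤i i<K | inY k≤j j<K = ≤-reflexive (trans (byClass-Y k≤i i<K) (sym (byClass-Y k≤j j<K)))
    ... | inY k≤i i<K | inZ K≤j     = subst₂ _≤_ (sym (byClass-Y k≤i i<K)) (sym (byClass-Z K≤j)) y≤z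
    ... | inZ K≤i     | inZ K≤j     = ≤-reflexive (trans (byClass-Z K≤i) (sym (byClass-Z K≤j)))
    ... | inY k≤i _   | inX j<k     = contradiction (≤-trans k≤i i≤j) (<⇒≱ j<k)
    ... | inZ K≤i     | inX j<k     = contradiction (≤-trans K≤i i≤j) (<⇒≱ (<-trans j<k k<K))
    ... | inZ K≤i     | inY _ j<K   = contradiction (≤-trans K≤i i≤j) (<⇒≱ j<K)

  -- j is adjacent to i iff j ≠ i and j ≥ reach i: a vertex of X sees only Z,
  -- one of Y sees Y ∪ Z, and one of Z sees everything.
  reach : ℕ → ℕ
  reach = byClass K k 0

  reach-sym : ∀ {i j} → reach i ≤ j → reach j ≤ i
  reach-sym {i} {j} reach[i]≤j with classify i | classify j
  ... | _           | inZ K≤j     = subst (_≤ i) (sym (byClass-Z K≤j)) z≤n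
  ... | inZ K≤i     | inX j<k     = subst (_≤ i) (sym (byClass-X j<k)) K≤i
  ... | inZ K≤i     | inY k≤j j<K = subst (_≤ i) (sym (byClass-Y k≤j j<K)) (≤-trans (<⇒≤ k<K) K≤i)
  ... | inY k≤i i<K | inY k≤j j<K = subst (_≤ i) (sym (byClass-Y k≤j j<K)) k≤i
  ... | inY k≤i i<K | inX j<k     = contradiction (subst (_≤ j) (byClass-Y k≤i i<K) reach[i]≤j) (<⇒≱ j<k)
  ... | inX i<k     | inX j<k     = contradiction (subst (_≤ j) (byClass-X i<k) reach[i]≤j) (<⇒≱ (<-trans j<k k<K))
  ... | inX i<k     | inY _ j<K   = contradiction (subst (_≤ j) (byClass-X i<k) reach[i]≤j) (<⇒≱ j<K)

  Adjacent : ℕ → ℕ → Set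
  Adjacent i = AboveExcept (reach i) i

  adjacent? : ∀ i → Decidable (Adjacent i)
  adjacent? i = aboveExcept? (reach i) i

  Adjacent-sym : ∀ {i j} → Adjacent i j → Adjacent j i
  Adjacent-sym (reach[i]≤j , i≢j) = reach-sym reach[i]≤j , i≢j ∘ sym

  G : Graph n
  G = record
    { adj    = λ u v → does (adjacent? (toℕ u) (toℕ v))
    ; sym    = λ u v → does-⇔ (mk⇔ Adjacent-sym Adjacent-sym)
                                (adjacent? (toℕ u) (toℕ v)) (adjacent? (toℕ v) (toℕ u))
    ; irrefl = λ u → dec-false (adjacent? (toℕ u) (toℕ u)) (λ (_ , u≢u) → u≢u refl)
    }

  adj-G⇒Adjacent : ∀ {u v} → adj G u v ≡ true → Adjacent (toℕ u) (toℕ v)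
  adj-G⇒Adjacent {u} {v} = Equivalence.to (does≡true⇔ (adjacent? (toℕ u) (toℕ v)))

  degreeOf : ℕ → ℕ
  degreeOf = byClass (n ∸ K) (n ∸ k ∸ 1) (n ∸ 1)

  degreeOf-mono : ∀ {i j} → i ≤ j → degreeOf i ≤ degreeOf j
  degreeOf-mono = byClass-mono (o<n⇒m∸n≤m∸o∸1 k<K) (∸-monoˡ-≤ 1 (m∸n≤m n k))

  private
    countBelow-adjacent-via : ∀ {i a d} → reach i ≡ a → countBelow n (aboveExcept? a i) ≡ d →
                              degreeOf i ≡ d → countBelow n (adjacent? i) ≡ degreeOf i
    countBelow-adjacent-via refl count≡d degreeOf≡d = trans count≡d (sym degreeOf≡d)

  countBelow-adjacent : ∀ {i} → i < n → countBelow n (adjacent? i) ≡ degreeOf i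
  countBelow-adjacent {i} i<n with classify i
  ... | inX i<k = countBelow-adjacent-via (byClass-X i<k)
                    (countBelow-aboveExcept-< (<-trans i<k k<K) K≤n) (byClass-X i<k)
  ... | inY k≤i i<K = countBelow-adjacent-via (byClass-Y k≤i i<K)
                        (countBelow-aboveExcept-≥ k≤i i<n) (byClass-Y k≤i i<K)
  ... | inZ K≤i = countBelow-adjacent-via (byClass-Z K≤i) (countBelow-aboveExcept-≥ z≤n i<n) (byClass-Z K≤i)

  degree-G : ∀ u → degree G u ≡ degreeOf (toℕ u)
  degree-G u = begin
    degree G u                        ≡⟨ length-filter-allFin adj[u]≡true? ⟩
    count adj[u]≡true?
      ≡⟨ count-cong adj[u]≡true? (adjacent? (toℕ u) ∘ toℕ) (does≡true⇔ ∘ adjacent? (toℕ u) ∘ toℕ) ⟩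
    countBelow n (adjacent? (toℕ u))  ≡⟨ countBelow-adjacent (toℕ<n u) ⟩
    degreeOf (toℕ u)                  ∎
    where
    open ≡-Reasoning
    adj[u]≡true? : Decidable (λ v → adj G u v ≡ true)
    adj[u]≡true? v = adj G u v ≟ᵇ true

  degreeSequence-G : degreeSequence G ≡ applyUpTo degreeOf n
  degreeSequence-G = begin
    sort (map (degree G) (allFin n))   ≡⟨ cong sort (map-tabulate id (degree G)) ⟩
    sort (tabulate (degree G))         ≡⟨ cong sort (tabulate-cong degree-G) ⟩
    sort (tabulate (degreeOf ∘ toℕ))   ≡⟨ cong sort (tabulate-toℕ n degreeOf) ⟩
    sort (applyUpTo degreeOf n)
      ≡⟨ sort-sorted (applyUpTo⁺₂ ≤-totalOrder degreeOf n (λ i → degreeOf-mono (n≤1+n i))) ⟩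
    applyUpTo degreeOf n               ∎
    where open ≡-Reasoning

  nth-degreeSequence-G : ∀ {p} → p < n → nth (degreeSequence G) (p + 1) ≡ degreeOf p
  nth-degreeSequence-G {p} p<n rewrite degreeSequence-G | +-comm p 1 = nth-applyUpTo degreeOf p<n

  nth-degreeSequence-G-Y : ∀ {p} → k ≤ p → p < K → nth (degreeSequence G) (p + 1) ≡ n ∸ k ∸ 1
  nth-degreeSequence-G-Y k≤p p<K = trans (nth-degreeSequence-G (<-≤-trans p<K K≤n)) (byClass-Y k≤p p<K)

  nth-degreeSequence-G-Z : ∀ {p} → K ≤ p → p < n → nth (degreeSequence G) (p + 1) ≡ n ∸ 1
  nth-degreeSequence-G-Z K≤p p<n = trans (nth-degreeSequence-G p<n) (byClass-Z K≤p)

  nth-degreeSequence-G-≥ : ∀ {p} → k ≤ p → p < n → n ∸ k ∸ 1 ≤ nth (degreeSequence G) (p + 1)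
  nth-degreeSequence-G-≥ k≤p p<n =
    subst₂ _≤_ (byClass-Y ≤-refl k<K) (sym (nth-degreeSequence-G p<n)) (degreeOf-mono k≤p)

  ¬perfectPacking-G : ∀ {r} → n ∸ K < (r ∸ 1) * k → ¬ PerfectPacking r G
  ¬perfectPacking-G {r} n∸K<[r∸1]k =
    small-neighbourhood⇒¬PerfectPacking G X? Z? N[X]⊆Z X∩Z≡∅
      (subst₂ (λ z x → z < (r ∸ 1) * x) (sym #Z≡n∸K) (sym #X≡k) n∸K<[r∸1]k)
    where
    X? : Decidable (λ v → toℕ v < k)
    X? v = toℕ v <? k
    Z? : Decidable (λ v → K ≤ toℕ v)
    Z? v = K ≤? toℕ v
    #X≡k : count X? ≡ k
    #X≡k = countBelow-< (<⇒≤ (<-≤-trans k<K K≤n))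
    #Z≡n∸K : count Z? ≡ n ∸ K
    #Z≡n∸K = countBelow-≥ K≤n
    N[X]⊆Z : ∀ {x v} → toℕ x < k → adj G x v ≡ true → K ≤ toℕ v
    N[X]⊆Z x<k xv = subst (_≤ _) (byClass-X x<k) (proj₁ (adj-G⇒Adjacent xv))
    X∩Z≡∅ : ∀ {v} → toℕ v < k → ¬ K ≤ toℕ v
    X∩Z≡∅ v<k = <⇒≱ (<-trans v<k k<K)

m+n*p≤o*[1+p] : ∀ {m n o p} → m ≤ o → n ≤ o → m + n * p ≤ o * suc p
m+n*p≤o*[1+p] {o = o} {p} m≤o n≤o =
  ≤-trans (+-mono-≤ m≤o (*-monoˡ-≤ p n≤o)) (≤-reflexive (sym (*-suc o p)))

proposition7p2 : (n r k : ℕ) → 2 ≤ r → (r∣n : r ∣ n) → 1 ≤ k → k ≤ quotient r∣n →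
    Σ (Graph n) λ G →
      (∀ i → 1 ≤ i → i ≤ quotient r∣n → i ≢ k →
        n ∸ i ≤ nth (degreeSequence G) (n ∸ i * (r ∸ 1) + 1)) ×
      (nth (degreeSequence G) (n ∸ k * (r ∸ 1) + 1) ≡ n ∸ k ∸ 1) ×
      ¬ PerfectPacking r G
proposition7p2 n (suc s) k (s≤s 1≤s@(s≤s z≤n)) (divides q n≡q[1+s]) 1≤k k≤q =
  G , degree-≢k , nth-degreeSequence-G-Y (k≤position k≤q) ≤-refl , ¬perfectPacking-G n∸K<sk
  where
  k+is≤n : ∀ {i} → i ≤ q → k + i * s ≤ n
  k+is≤n i≤q = subst (_ ≤_) (sym n≡q[1+s]) (m+n*p≤o*[1+p] k≤q i≤q)

  k≤position : ∀ {i} → i ≤ q → k ≤ n ∸ i * s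
  k≤position i≤q = m+n≤o⇒m≤o∸n k (k+is≤n i≤q)

  position<n : ∀ {i} → 1 ≤ i → i ≤ q → n ∸ i * s < n
  position<n 1≤i i≤q = ∸-monoʳ-< (*-mono-≤ 1≤i 1≤s) (m+n≤o⇒n≤o k (k+is≤n i≤q))

  ks≤n : k * s ≤ n
  ks≤n = m+n≤o⇒n≤o k (k+is≤n k≤q)

  -- Z = [K, n) then has k(r − 1) − 1 vertices.
  K = suc (n ∸ k * s)
  open Construction n k K (s≤s (k≤position k≤q)) (position<n 1≤k k≤q)

  degree-≢k : ∀ i → 1 ≤ i → i ≤ q → i ≢ k → n ∸ i ≤ nth (degreeSequence G) (n ∸ i * s + 1)
  degree-≢k i 1≤i i≤q i≢k with <-cmp i k
  ... | tri< i<k _ _ = subst (n ∸ i ≤_)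
                         (sym (nth-degreeSequence-G-Z (∸-monoʳ-< (*-monoˡ-< s i<k) ks≤n) (position<n 1≤i i≤q)))
                         (∸-monoʳ-≤ n 1≤i)
  ... | tri≈ _ i≡k _ = contradiction i≡k i≢k
  ... | tri> _ _ k<i = ≤-trans (o<n⇒m∸n≤m∸o∸1 k<i)
                                (nth-degreeSequence-G-≥ (k≤position i≤q) (position<n 1≤i i≤q))

  n∸K<sk : n ∸ K < s * k
  n∸K<sk = subst (n ∸ K <_) (trans (m∸[m∸n]≡n ks≤n) (*-comm k s))
                 (∸-monoʳ-< (n<1+n (n ∸ k * s)) (position<n 1≤k k≤q))
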